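{- (a) Assume Conjecture A (stated in the context). Then for each $b\in\{3,4\}$ and every positive integer $t$ there is a positive integer $n$ with $\nu_{1,b}(n)\ge t$. (b) Assume Conjecture B (stated in the context). Then for every integer $b\ge 5$ and every positive integer $t$ there is a positive integer $n$ with $\nu_{1,b}(n)\ge t$.
   Context: For integers $t\ge 0$, $b\ge 2$, the $t$-shifted Sloane map in base $b$ is $S_{t,b}(n)=\prod_{i=0}^k (d_i+t)$, where $n=\sum_{i=0}^k d_ib^i$ is the base-$b$ expansion of $n$ ($0\le d_i\le b-1$, $d_k>0$). $f^k$ denotes the $k$-th iterate of $f$. The persistence $\nu_{1,b}(n)$ is the smallest $k\ge0$ such that $S_{1,b}^k(n)$ is a periodic point of $S_{1,b}$ (i.e. the number of iterations to reach a fixed point or cycle). For a base $q$, a digit $d$ and a positive integer $n$, $\#d(n)_q$ is the number of occurrences of $d$ in the base-$q$ expansion of $n$ and $\#(n)_q$ the number of base-$q$ digits of $n$. Given $\varepsilon>0$, $n$ is $\varepsilon$-equidistributed in base $q$ if $\left|\frac{\#d(n)_q}{\#(n)_q}-\frac1q\right|<\varepsilon$ for every $d\in\{0,\dots,q-1\}$. Conjecture A: For every integer $q>1$, every finite set $F$ of primes that does not contain all primes dividing $q$, and every positive integer $a$, if $N_0=a$ and $N_{k+1}=N_kp_k$ with $p_k\in F$ for all $k\ge0$, then for every $\varepsilon>0$ there is $n_0$ such that $N_n$ is $\varepsilon$-equidistributed in base $q$ for all $n\ge n_0$. Conjecture B: For every integer $q>1$, every finite set $F=\{p_1,\dots,p_k\}$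 of primes that does not contain all primes dividing $q$, and every positive integer $a$, for every $\varepsilon>0$ there exists $N$ such that $a\prod_{i=1}^k p_i^{\alpha_i}$ (nonnegative integers $\alpha_i$) is $\varepsilon$-equidistributed in base $q$ whenever $\alpha_i\ge N$ for some $i$. -}

module Defs where

open import Data.Nat using (ℕ; zero; suc; _*_; _+_; _≤_; _<_; _%_; _/_; _≟_)
open import Data.Nat.Divisibility using (_∣_)
open import Data.Nat.Primality using (Prime)
open import Data.List using (List; []; _∷_; length; filter; map)
open import Data.Nat.ListAction using (product)
open import Data.List.Membership.Propositional using (_∈_)
open import Data.List.Relation.Unary.All using (All)
open import Data.Fin using (Fin)
open import Data.Integer using (+_)
open import Data.Rational as ℚ using (ℚ; 0ℚ; ∣_∣; _-_; Positive)
open import Data.Product using (Σ; ∃; _×_; _,_)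
open import Relation.Nullary using (¬_)
open import Relation.Binary.PropositionalEquality using (_≡_)
open import Function.Definitions using (Injective)

-- base-b digits of n, least significant first (fuel-bounded; fuel n suffices for b ≥ 2).
digitsFuel : (b : ℕ) → .{{_ : Data.Nat.NonZero b}} → ℕ → ℕ → List ℕ
digitsFuel b zero n = []
digitsFuel b (suc f) zero = []
digitsFuel b (suc f) (suc n) = (suc n % b) ∷ digitsFuel b f (suc n / b)

-- base-b expansion (d_0, …, d_k) of n; empty for n = 0 (base 0 is meaningless).
digits : ℕ → ℕ → List ℕ
digits zero n = []
digits (suc b) n = digitsFuel (suc b) n n

sloane : ℕ → ℕ → ℕ → ℕ
sloane t b n = product (map (λ d → d + t) (digits b n))

iter : (ℕ → ℕ) → ℕ → ℕ → ℕ
iter f zero x = x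
iter f (suc k) x = f (iter f k x)

Periodic : (ℕ → ℕ) → ℕ → Set
Periodic f x = Σ ℕ λ m → iter f (suc m) x ≡ x

-- ν_{1,b}(n) ≥ t : the least k with S_{1,b}^k(n) periodic is ≥ t,
-- i.e. no k < t has S_{1,b}^k(n) periodic.
PersistenceAtLeast : (b t n : ℕ) → Set
PersistenceAtLeast b t n = ∀ k → k < t → ¬ Periodic (sloane 1 b) (iter (sloane 1 b) k n)

countDigit : (q d n : ℕ) → ℕ
countDigit q d n = length (filter (d ≟_) (digits q n))

numDigits : (q n : ℕ) → ℕ
numDigits q n = length (digits q n)

-- the rational a / m (0 when m = 0, a case never used since n > 0)
frac : ℕ → ℕ → ℚ
frac a zero = 0ℚ
frac a (suc m) = (+ a) ℚ./ suc m

Equidistributed : (q : ℕ) → ℚ → ℕ → Set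
Equidistributed q ε n =
  ∀ d → d < q → ∣ frac (countDigit q d n) (numDigits q n) - frac 1 q ∣ ℚ.< ε

prodSeq : ℕ → (ℕ → ℕ) → ℕ → ℕ
prodSeq a p zero = a
prodSeq a p (suc k) = prodSeq a p k * p k

prodFin : (k : ℕ) → (Fin k → ℕ) → ℕ
prodFin zero f = 1
prodFin (suc k) f = f Fin.zero * prodFin k (λ i → f (Fin.suc i))

ConjectureA : Set
ConjectureA =
  (q : ℕ) → 1 < q →
  (F : List ℕ) → All Prime F →
  ¬ (∀ p → Prime p → p ∣ q → p ∈ F) →
  (a : ℕ) → 1 ≤ a →
  (p : ℕ → ℕ) → (∀ k → p k ∈ F) →
  (ε : ℚ) → Positive ε →
  ∃ λ n₀ → ∀ n → n₀ ≤ n → Equidistributed q ε (prodSeq a p n)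

-- F = {p_1, …, p_k} given as an injective family of primes
ConjectureB : Set
ConjectureB =
  (q : ℕ) → 1 < q →
  (k : ℕ) → (ps : Fin k → ℕ) → Injective _≡_ _≡_ ps → (∀ i → Prime (ps i)) →
  ¬ (∀ p → Prime p → p ∣ q → ∃ λ i → ps i ≡ p) →
  (a : ℕ) → 1 ≤ a →
  (ε : ℚ) → Positive ε →
  ∃ λ N → ∀ (α : Fin k → ℕ) → (∃ λ i → N ≤ α i) →
    Equidistributed q ε (a * prodFin k (λ i → ps i Data.Nat.^ α i))

-- Every value S u of the Sloane map is B-smooth, hence of the form B^i * w with B ∤ w, and the
-- conjectures make such w equidistributed in base B once w is large: every digit then occurs more
-- than L w / 2B times. A large w has at least two zero digits,
-- so S (S u) < S u / B once S u is large; together with S x ≤ B x no cycle of S contains a large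
-- number. Next fix a digit δ < B with δ + 1 prime and δ + 1 ∤ B. If w has many digits, then
-- (δ + 1)^(L w / 2B) divides S (B^i w), and since δ + 1 ∤ B this divisibility lands in the
-- B-free part, which therefore still has at least L w / 2B² digits. Starting from the repdigit
-- δδ…δ, whose image is a large power of δ + 1, the first t iterates all stay large.

module Submission where

open import Defs
open import Data.Nat
open import Data.Nat.Properties
open import Data.Nat.DivMod
open import Data.Nat.Divisibility
  using (_∣_; _∤_; divides; ∣-refl; ∣-trans; ∣⇒≤; m∣m*n; ∣n⇒∣m*n; *-monoʳ-∣; *-cancelˡ-∣; ∣m+n∣m⇒∣n)
open import Data.Nat.Induction using (<-rec)
open import Data.Nat.ListAction using (product)
open import Data.Nat.Primality using (Prime; prime?; prime[2]; ¬prime[0]; prime⇒nonZero; prime⇒nonTrivial; euclidsLemma; productOfPrimes≢0)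
open import Data.Nat.Primality.Factorisation using (factorise; PrimeFactorisation)
open import Data.List using (List; []; _∷_; length; filter; map; replicate; _++_; lookup; upTo)
open import Data.List.Relation.Unary.All as All using (All; []; _∷_)
open import Data.List.Relation.Unary.AllPairs using (_∷_)
open import Data.List.Relation.Unary.Any using (here; there; index)
open import Data.List.Relation.Unary.Any.Properties using (lookup-index)
open import Data.List.Relation.Unary.Unique.Propositional using (Unique)
open import Data.List.Relation.Unary.Unique.Propositional.Properties using (upTo⁺; filter⁺)
open import Data.List.Membership.Propositional using (_∈_)
open import Data.List.Membership.Propositional.Properties using (∈-lookup; ∈-upTo⁺; ∈-upTo⁻; ∈-filter⁺; ∈-filter⁻)
open import Data.List.Properties using (filter-accept; filter-reject)
open import Data.Fin using (Fin; punchIn; cast) renaming (zero to fzero; suc to fsuc)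
import Data.Fin.Properties as Fin
open import Data.Product using (Σ; ∃; _×_; _,_; proj₁; proj₂)
open import Data.Sum using (_⊎_; inj₁; inj₂; [_,_]′)
open import Data.Empty using (⊥-elim)
open import Relation.Nullary using (¬_; yes; no; contradiction)
open import Relation.Binary.PropositionalEquality
open import Function using (_∘_)
open import Function.Definitions using (Injective)
import Data.Integer as ℤ
import Data.Integer.Properties as ℤ
open import Data.Integer.Tactic.RingSolver using (solve-∀)
import Data.Rational as ℚ
import Data.Rational.Properties as ℚ
import Data.Rational.Unnormalised as ℚᵘ
import Data.Rational.Unnormalised.Properties as ℚᵘ
open import Algebra.Properties.AbelianGroup ℚ.+-0-abelianGroup using (⁻¹-anti-homo‿-)
open import Algebra.Properties.CommutativeSemigroup *-commutativeSemigroup using (x∙yz≈y∙xz)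

prime⇒2≤ : ∀ {p} → Prime p → 2 ≤ p
prime⇒2≤ {p} p-prime = nonTrivial⇒n>1 p {{prime⇒nonTrivial p-prime}}

prime^n>0 : ∀ {p} → Prime p → ∀ n → 1 ≤ p ^ n
prime^n>0 {p} p-prime n = m^n>0 p {{prime⇒nonZero p-prime}} n

n<2^n : ∀ n → n < 2 ^ n
n<2^n zero = s≤s z≤n
n<2^n (suc n) = begin-strict
  suc n             ≤⟨ n<2^n n ⟩
  2 ^ n             <⟨ m<m+n (2 ^ n) (m^n>0 2 n) ⟩
  2 ^ n + 2 ^ n     ≡⟨ cong (2 ^ n +_) (sym (+-identityʳ (2 ^ n))) ⟩
  2 ^ suc n         ∎
  where open ≤-Reasoning

^-cancelʳ-< : ∀ m .{{_ : NonZero m}} {a b} → m ^ a < m ^ b → a < b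
^-cancelʳ-< m {a} {b} m^a<m^b with a <? b
... | yes a<b = a<b
... | no a≮b = contradiction (^-monoʳ-≤ m (≮⇒≥ a≮b)) (<⇒≱ m^a<m^b)

m∣m^n : ∀ m {n} → 1 ≤ n → m ∣ m ^ n
m∣m^n m {suc n} _ = m∣m*n (m ^ n)

prime∤⇒∤^ : ∀ {p m} → Prime p → p ∤ m → ∀ i → p ∤ m ^ i
prime∤⇒∤^ p-prime p∤m zero p∣1 = contradiction (∣⇒≤ p∣1) (<⇒≱ (prime⇒2≤ p-prime))
prime∤⇒∤^ {m = m} p-prime p∤m (suc i) p∣m^1+i =
  [ p∤m , prime∤⇒∤^ p-prime p∤m i ]′ (euclidsLemma m (m ^ i) p-prime p∣m^1+i)

prime^∣-cancelˡ : ∀ {p m} → Prime p → p ∤ m → ∀ c n → p ^ c ∣ m * n → p ^ c ∣ n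
prime^∣-cancelˡ p-prime p∤m zero n _ = divides n (sym (*-identityʳ n))
prime^∣-cancelˡ {p} {m} p-prime p∤m (suc c) n p^1+c∣mn
  with euclidsLemma m n p-prime (∣-trans (m∣m*n (p ^ c)) p^1+c∣mn)
... | inj₁ p∣m = contradiction p∣m p∤m
... | inj₂ (divides k refl) =
  subst (p * p ^ c ∣_) (*-comm p k) (*-monoʳ-∣ p (prime^∣-cancelˡ p-prime p∤m c k p^c∣mk))
  where
  p^c∣mk : p ^ c ∣ m * k
  p^c∣mk = *-cancelˡ-∣ p {{prime⇒nonZero p-prime}}
    (subst (p * p ^ c ∣_) (trans (sym (*-assoc m k p)) (*-comm (m * k) p)) p^1+c∣mn)

argmax-≤ : (g : ℕ → ℕ) (m : ℕ) → ∃ λ j → j ≤ m × (∀ i → i ≤ m → g i ≤ g j)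
argmax-≤ g zero = 0 , z≤n , λ { zero _ → ≤-refl }
argmax-≤ g (suc m) with argmax-≤ g m
... | j , j≤m , max with g (suc m) ≤? g j
...   | yes gm≤gj = j , m≤n⇒m≤1+n j≤m , λ i i≤1+m →
  [ (λ i<1+m → max i (s≤s⁻¹ i<1+m)) , (λ { refl → gm≤gj }) ]′ (m≤n⇒m<n∨m≡n i≤1+m)
...   | no gm≰gj = suc m , ≤-refl , λ i i≤1+m →
  [ (λ i<1+m → ≤-trans (max i (s≤s⁻¹ i<1+m)) (<⇒≤ (≰⇒> gm≰gj))) , (λ { refl → ≤-refl }) ]′
    (m≤n⇒m<n∨m≡n i≤1+m)

frac-mono-≤ : ∀ a m b n → a * suc n ≤ b * suc m → frac a (suc m) ℚ.≤ frac b (suc n)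
frac-mono-≤ a m b n an≤bm = ℚ.toℚᵘ-cancel-≤
  (ℚᵘ.≤-respˡ-≃ (ℚᵘ.≃-sym (ℚ.toℚᵘ-fromℚᵘ (ℚᵘ.mkℚᵘ (ℤ.+ a) m)))
  (ℚᵘ.≤-respʳ-≃ (ℚᵘ.≃-sym (ℚ.toℚᵘ-fromℚᵘ (ℚᵘ.mkℚᵘ (ℤ.+ b) n)))
  (ℚᵘ.*≤* (subst₂ ℤ._≤_ (ℤ.pos-* a (suc n)) (ℤ.pos-* b (suc m)) (ℤ.+≤+ an≤bm)))))

p≤∣p∣ : ∀ p → p ℚ.≤ ℚ.∣ p ∣
p≤∣p∣ p with ℚ.≤-total ℚ.0ℚ p
... | inj₁ 0≤p = ℚ.≤-reflexive (sym (ℚ.0≤p⇒∣p∣≡p 0≤p))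
... | inj₂ p≤0 = ℚ.≤-trans p≤0 (ℚ.0≤∣p∣ p)

q-p≤∣p-q∣ : ∀ p q → q ℚ.- p ℚ.≤ ℚ.∣ p ℚ.- q ∣
q-p≤∣p-q∣ p q = begin
  q ℚ.- p         ≡⟨ ⁻¹-anti-homo‿- p q ⟨
  ℚ.- (p ℚ.- q)   ≤⟨ p≤∣p∣ (ℚ.- (p ℚ.- q)) ⟩
  ℚ.∣ ℚ.- (p ℚ.- q) ∣ ≡⟨ ℚ.∣-p∣≡∣p∣ (p ℚ.- q) ⟩
  ℚ.∣ p ℚ.- q ∣     ∎
  where open ℚ.≤-Reasoning

1/b-1/2b≡1/2b : ∀ q → frac 1 (suc q) ℚ.- frac 1 (suc q + suc q) ≡ frac 1 (suc q + suc q)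
1/b-1/2b≡1/2b q = ℚ.toℚᵘ-injective (begin
  ℚ.toℚᵘ (y ℚ.- e)          ≈⟨ ℚ.toℚᵘ-homo-+ y (ℚ.- e) ⟩
  ℚ.toℚᵘ y ℚᵘ.+ ℚ.toℚᵘ (ℚ.- e) ≈⟨ ℚᵘ.+-cong (ℚ.toℚᵘ-fromℚᵘ Y)
                                    (ℚᵘ.≃-trans (ℚ.toℚᵘ-homo‿- e) (ℚᵘ.-‿cong (ℚ.toℚᵘ-fromℚᵘ E))) ⟩
  Y ℚᵘ.- E                  ≈⟨ ℚᵘ.*≡* cross ⟩
  E                         ≈⟨ ℚ.toℚᵘ-fromℚᵘ E ⟨
  ℚ.toℚᵘ e                  ∎)
  where
  open ℚᵘ.≃-Reasoning
  y = frac 1 (suc q)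
  e = frac 1 (suc q + suc q)
  Y = ℚᵘ.mkℚᵘ (ℤ.+ 1) q
  E = ℚᵘ.mkℚᵘ (ℤ.+ 1) (q + suc q)
  b = ℤ.+ suc q
  2b≡b+b : ℤ.+ suc (q + suc q) ≡ b ℤ.+ b
  2b≡b+b = ℤ.pos-+ (suc q) (suc q)
  ring : ∀ b → ((ℤ.+ 1) ℤ.* (b ℤ.+ b) ℤ.+ (ℤ.- ℤ.+ 1) ℤ.* b) ℤ.* (b ℤ.+ b) ≡ (ℤ.+ 1) ℤ.* (b ℤ.* (b ℤ.+ b))
  ring = solve-∀
  cross : ((ℤ.+ 1) ℤ.* ℤ.+ suc (q + suc q) ℤ.+ (ℤ.- ℤ.+ 1) ℤ.* b) ℤ.* ℤ.+ suc (q + suc q)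
        ≡ (ℤ.+ 1) ℤ.* ℤ.+ (suc q * suc (q + suc q))
  cross = trans (cong₂ (λ u v → ((ℤ.+ 1) ℤ.* u ℤ.+ (ℤ.- ℤ.+ 1) ℤ.* b) ℤ.* v) 2b≡b+b 2b≡b+b)
    (trans (ring b) (cong ((ℤ.+ 1) ℤ.*_)
      (trans (cong (b ℤ.*_) (sym 2b≡b+b)) (sym (ℤ.pos-* (suc q) (suc (q + suc q)))))))

∣c/m-1/b∣<1/2b⇒m<2bc : ∀ q c m →
  ℚ.∣ frac c (suc m) ℚ.- frac 1 (suc q) ∣ ℚ.< frac 1 (suc q + suc q) → suc m < (suc q + suc q) * c
∣c/m-1/b∣<1/2b⇒m<2bc q c m close with suc m <? (suc q + suc q) * c
... | yes m<2bc = m<2bc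
... | no m≮2bc = ⊥-elim (ℚ.<-irrefl refl (ℚ.<-≤-trans close (begin
  e                 ≡⟨ 1/b-1/2b≡1/2b q ⟨
  y ℚ.- e           ≤⟨ ℚ.+-monoʳ-≤ y (ℚ.neg-antimono-≤ x≤e) ⟩
  y ℚ.- x           ≤⟨ q-p≤∣p-q∣ x y ⟩
  ℚ.∣ x ℚ.- y ∣     ∎)))
  where
  open ℚ.≤-Reasoning
  x = frac c (suc m)
  y = frac 1 (suc q)
  e = frac 1 (suc q + suc q)
  x≤e : x ℚ.≤ e
  x≤e = frac-mono-≤ c m 1 (q + suc q)
    (subst₂ _≤_ (*-comm (suc q + suc q) c) (sym (*-identityˡ (suc m))) (≮⇒≥ m≮2bc))

iter-suc : ∀ (f : ℕ → ℕ) k x → iter f (suc k) x ≡ iter f k (f x)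
iter-suc f zero x = refl
iter-suc f (suc k) x = cong f (iter-suc f k x)

module _ (g : ℕ → ℕ) {y m : ℕ} (cycle : iter g (suc m) y ≡ y) where

  cycle-predecessor : ∀ j → j ≤ m → ∃ λ j′ → j′ ≤ m × iter g j y ≡ g (iter g j′ y)
  cycle-predecessor zero _ = m , ≤-refl , sym cycle
  cycle-predecessor (suc j) j<m = j , <⇒≤ j<m , refl

  -- g (g u) is a maximum of the cycle through y, and g u is its predecessor on the cycle.
  cycle-peak : ∃ λ u → y ≤ g (g u) × g u ≤ g (g u)
  cycle-peak with argmax-≤ (λ j → iter g j y) m
  ... | j , j≤m , max with cycle-predecessor j j≤m
  ... | j′ , j′≤m , j≡gj′ with cycle-predecessor j′ j′≤m
  ... | j″ , _ , j′≡gj″ =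
    iter g j″ y ,
    subst (y ≤_) peak (max 0 z≤n) ,
    subst₂ _≤_ j′≡gj″ peak (max j′ j′≤m)
    where
    peak : iter g j y ≡ g (g (iter g j″ y))
    peak = trans j≡gj′ (cong g j′≡gj″)

prodFin-cong : ∀ k {f g : Fin k → ℕ} → (∀ i → f i ≡ g i) → prodFin k f ≡ prodFin k g
prodFin-cong zero f≗g = refl
prodFin-cong (suc k) f≗g = cong₂ _*_ (f≗g fzero) (prodFin-cong k (f≗g ∘ fsuc))

prodFin-* : ∀ k (f g : Fin k → ℕ) → prodFin k (λ i → f i * g i) ≡ prodFin k f * prodFin k g
prodFin-* zero f g = refl
prodFin-* (suc k) f g = trans (cong (f fzero * g fzero *_) (prodFin-* k (f ∘ fsuc) (g ∘ fsuc)))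
  ([m*n]*[o*p]≡[m*o]*[n*p] (f fzero) (g fzero) _ _)

prodFin-const : ∀ k a → prodFin k (λ _ → a) ≡ a ^ k
prodFin-const zero a = refl
prodFin-const (suc k) a = cong (a *_) (prodFin-const k a)

prodFin-punchIn : ∀ k (f : Fin (suc k) → ℕ) r → prodFin (suc k) f ≡ f r * prodFin k (f ∘ punchIn r)
prodFin-punchIn k f fzero = refl
prodFin-punchIn (suc k) f (fsuc r) =
  trans (cong (f fzero *_) (prodFin-punchIn k (f ∘ fsuc) r)) (x∙yz≈y∙xz (f fzero) (f (fsuc r)) _)

prodFin-mono-≤ : ∀ k {f g : Fin k → ℕ} → (∀ i → f i ≤ g i) → prodFin k f ≤ prodFin k g
prodFin-mono-≤ zero f≤g = ≤-refl
prodFin-mono-≤ (suc k) f≤g = *-mono-≤ (f≤g fzero) (prodFin-mono-≤ k (f≤g ∘ fsuc))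

unitVector : ∀ {k} → Fin k → Fin k → ℕ
unitVector fzero fzero = 1
unitVector fzero (fsuc _) = 0
unitVector (fsuc _) fzero = 0
unitVector (fsuc j) (fsuc i) = unitVector j i

prodFin-^unitVector : ∀ k (f : Fin k → ℕ) j → prodFin k (λ i → f i ^ unitVector j i) ≡ f j
prodFin-^unitVector (suc k) f fzero = begin
  f fzero * 1 * prodFin k (λ _ → 1) ≡⟨ cong₂ _*_ (*-identityʳ (f fzero)) (prodFin-const k 1) ⟩
  f fzero * 1 ^ k                   ≡⟨ cong (f fzero *_) (^-zeroˡ k) ⟩
  f fzero * 1                       ≡⟨ *-identityʳ (f fzero) ⟩
  f fzero                           ∎
  where open ≡-Reasoning
prodFin-^unitVector (suc k) f (fsuc j) = trans (+-identityʳ _) (prodFin-^unitVector k (f ∘ fsuc) j)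

UpwardClosed : (ℕ → Set) → Set
UpwardClosed Q = ∀ {m n} → m ≤ n → Q m → Q n

uniform-bound-Fin : ∀ {k} (Q : Fin k → ℕ → Set) → (∀ i → UpwardClosed (Q i)) →
                    (∀ i → ∃ (Q i)) → ∃ λ N → ∀ i → Q i N
uniform-bound-Fin {zero} Q up bound = 0 , λ ()
uniform-bound-Fin {suc k} Q up bound with bound fzero | uniform-bound-Fin (Q ∘ fsuc) (up ∘ fsuc) (bound ∘ fsuc)
... | N₀ , Q₀ | N , Qₛ = N₀ ⊔ N , λ
  { fzero → up fzero (m≤m⊔n N₀ N) Q₀
  ; (fsuc i) → up (fsuc i) (m≤n⊔m N₀ N) (Qₛ i) }

uniform-bound-< : ∀ m (Q : ℕ → ℕ → Set) → (∀ e → UpwardClosed (Q e)) →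
                  (∀ e → e < m → ∃ (Q e)) → ∃ λ N → ∀ e → e < m → Q e N
uniform-bound-< zero Q up bound = 0 , λ _ ()
uniform-bound-< (suc m) Q up bound with bound m ≤-refl | uniform-bound-< m Q up (λ e e<m → bound e (m≤n⇒m≤1+n e<m))
... | Nₘ , Qₘ | N , Q< = Nₘ ⊔ N , λ e e≤m →
  [ (λ e<m → up e (m≤n⊔m Nₘ N) (Q< e e<m)) , (λ { refl → up m (m≤m⊔n Nₘ N) Qₘ }) ]′ (m≤n⇒m<n∨m≡n (s≤s⁻¹ e≤m))

module Base (c : ℕ) where

  B : ℕ
  B = suc (suc c)

  S : ℕ → ℕ
  S = sloane 1 B

  L : ℕ → ℕ
  L = numDigits B

  suc-/B< : ∀ n → suc n / B < suc n
  suc-/B< n = m/n<m (suc n) B (s≤s (s≤s z≤n))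

  digitsFuel-irrelevant : ∀ f g n → n ≤ f → n ≤ g → digitsFuel B f n ≡ digitsFuel B g n
  digitsFuel-irrelevant zero zero zero _ _ = refl
  digitsFuel-irrelevant zero (suc g) zero _ _ = refl
  digitsFuel-irrelevant (suc f) zero zero _ _ = refl
  digitsFuel-irrelevant (suc f) (suc g) zero _ _ = refl
  digitsFuel-irrelevant (suc f) (suc g) (suc n) (s≤s n≤f) (s≤s n≤g) =
    cong (suc n % B ∷_) (digitsFuel-irrelevant f g (suc n / B) (≤-trans q≤n n≤f) (≤-trans q≤n n≤g))
    where
    q≤n : suc n / B ≤ n
    q≤n = s≤s⁻¹ (suc-/B< n)

  digits-suc : ∀ n → digits B (suc n) ≡ suc n % B ∷ digits B (suc n / B)
  digits-suc n = cong (suc n % B ∷_) (digitsFuel-irrelevant n (suc n / B) (suc n / B) (s≤s⁻¹ (suc-/B< n)) ≤-refl)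

  numDigits-suc : ∀ n → L (suc n) ≡ suc (L (suc n / B))
  numDigits-suc n = cong length (digits-suc n)

  digits-< : ∀ n → All (_< B) (digits B n)
  digits-< n = go n n
    where
    go : ∀ f n → All (_< B) (digitsFuel B f n)
    go zero n = []
    go (suc f) zero = []
    go (suc f) (suc n) = m%n<n (suc n) B ∷ go f (suc n / B)

  digits-+* : ∀ d n → d < B → 1 ≤ d + n * B → digits B (d + n * B) ≡ d ∷ digits B n
  digits-+* d n d<B 1≤x with d + n * B in x≡
  ... | suc x = trans (digits-suc x) (cong₂ (λ r q → r ∷ digits B q) x%B≡d x/B≡n)
    where
    x%B≡d : suc x % B ≡ d
    x%B≡d = trans (cong (_% B) (sym x≡)) (trans ([m+kn]%n≡m%n d n B) (m<n⇒m%n≡m d<B))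
    x/B≡n : suc x / B ≡ n
    x/B≡n = *-cancelʳ-≡ (suc x / B) n B (+-cancelˡ-≡ d _ _ (begin
      d + suc x / B * B        ≡⟨ cong (_+ suc x / B * B) x%B≡d ⟨
      suc x % B + suc x / B * B ≡⟨ m≡m%n+[m/n]*n (suc x) B ⟨
      suc x                    ≡⟨ x≡ ⟨
      d + n * B                ∎))
      where open ≡-Reasoning

  digits-B^* : ∀ i w → 1 ≤ w → digits B (B ^ i * w) ≡ replicate i 0 ++ digits B w
  digits-B^* zero w _ = cong (digits B) (+-identityʳ w)
  digits-B^* (suc i) w 1≤w = begin
    digits B (B * B ^ i * w)     ≡⟨ cong (digits B) (trans (*-assoc B (B ^ i) w) (*-comm B (B ^ i * w))) ⟩
    digits B (0 + B ^ i * w * B) ≡⟨ digits-+* 0 (B ^ i * w) (s≤s z≤n) (*-mono-≤ (*-mono-≤ (m^n>0 B i) 1≤w) (s≤s z≤n)) ⟩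
    0 ∷ digits B (B ^ i * w)     ≡⟨ cong (0 ∷_) (digits-B^* i w 1≤w) ⟩
    0 ∷ replicate i 0 ++ digits B w ∎
    where open ≡-Reasoning

  count₀-B^* : ∀ i w → 1 ≤ w → countDigit B 0 (B ^ i * w) ≡ i + countDigit B 0 w
  count₀-B^* i w 1≤w = trans (cong (λ ds → length (filter (0 ≟_) ds)) (digits-B^* i w 1≤w)) (go i)
    where
    go : ∀ i → length (filter (0 ≟_) (replicate i 0 ++ digits B w)) ≡ i + countDigit B 0 w
    go zero = refl
    go (suc i) = cong suc (go i)

  count-B^* : ∀ d i w → 1 ≤ d → 1 ≤ w → countDigit B d (B ^ i * w) ≡ countDigit B d w
  count-B^* (suc d) i w _ 1≤w = trans (cong (λ ds → length (filter (suc d ≟_) ds)) (digits-B^* i w 1≤w)) (go i)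
    where
    go : ∀ i → length (filter (suc d ≟_) (replicate i 0 ++ digits B w)) ≡ countDigit B (suc d) w
    go zero = refl
    go (suc i) = go i

  n<B^L : ∀ n → n < B ^ L n
  n<B^L = <-rec (λ n → n < B ^ L n) go
    where
    go : ∀ n → (∀ {m} → m < n → m < B ^ L m) → n < B ^ L n
    go zero _ = s≤s z≤n
    go (suc n) rec = begin-strict
      suc n                    ≡⟨ m≡m%n+[m/n]*n (suc n) B ⟩
      suc n % B + q * B        <⟨ +-monoˡ-< (q * B) (m%n<n (suc n) B) ⟩
      suc q * B                ≤⟨ *-monoˡ-≤ B (rec (suc-/B< n)) ⟩
      B ^ L q * B              ≡⟨ *-comm (B ^ L q) B ⟩
      B ^ suc (L q)            ≡⟨ cong (B ^_) (numDigits-suc n) ⟨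
      B ^ L (suc n)            ∎
      where
      open ≤-Reasoning
      q = suc n / B

  B^L≤B* : ∀ n → 1 ≤ n → B ^ L n ≤ B * n
  -- The auxiliary bound carries ⊔ 1 so that it also holds at n = 0, where L 0 = 0.
  B^L≤B* n 1≤n =
    ≤-trans (<-rec (λ n → B ^ L n ≤ B * n ⊔ 1) go n) (≤-reflexive (m≥n⇒m⊔n≡m (*-mono-≤ {1} {B} (s≤s z≤n) 1≤n)))
    where
    go : ∀ n → (∀ {m} → m < n → B ^ L m ≤ B * m ⊔ 1) → B ^ L n ≤ B * n ⊔ 1
    go zero _ = m≤n⊔m (B * 0) 1
    go (suc n) rec = begin
      B ^ L (suc n)         ≡⟨ cong (B ^_) (numDigits-suc n) ⟩
      B * B ^ L q           ≤⟨ *-monoʳ-≤ B (rec (suc-/B< n)) ⟩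
      B * (B * q ⊔ 1)       ≤⟨ *-monoʳ-≤ B (⊔-lub (subst (_≤ suc n) (*-comm q B) (m/n*n≤m (suc n) B)) (s≤s z≤n)) ⟩
      B * suc n             ≤⟨ m≤m⊔n (B * suc n) 1 ⟩
      B * suc n ⊔ 1         ∎
      where
      open ≤-Reasoning
      q = suc n / B

  sloane-pos : ∀ n → 1 ≤ S n
  sloane-pos n = go (digits B n)
    where
    go : ∀ ds → 1 ≤ product (map (λ d → d + 1) ds)
    go [] = s≤s z≤n
    go (d ∷ ds) = *-mono-≤ (m≤n+m 1 d) (go ds)

  -- Each digit d contributes a factor d + 1 ≤ B to S n, and each zero digit only 1, a factor B less.
  sloane*B^count₀≤ : ∀ n → 1 ≤ n → S n * B ^ countDigit B 0 n ≤ B * n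
  sloane*B^count₀≤ n 1≤n = ≤-trans (go (digits B n) (digits-< n)) (B^L≤B* n 1≤n)
    where
    go : ∀ ds → All (_< B) ds →
         product (map (λ d → d + 1) ds) * B ^ length (filter (0 ≟_) ds) ≤ B ^ length ds
    go [] [] = s≤s z≤n
    go (zero ∷ ds) (_ ∷ ds<B) = begin
      (1 * P) * (B * Z) ≡⟨ cong (_* (B * Z)) (*-identityˡ P) ⟩
      P * (B * Z)       ≡⟨ x∙yz≈y∙xz P B Z ⟩
      B * (P * Z)       ≤⟨ *-monoʳ-≤ B (go ds ds<B) ⟩
      B * B ^ length ds ∎
      where
      open ≤-Reasoning
      P = product (map (λ d → d + 1) ds)
      Z = B ^ length (filter (0 ≟_) ds)
    go (suc d ∷ ds) (d<B ∷ ds<B) = begin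
      (suc d + 1) * P * Z ≡⟨ *-assoc (suc d + 1) P Z ⟩
      (suc d + 1) * (P * Z) ≤⟨ *-mono-≤ (≤-trans (≤-reflexive (+-comm (suc d) 1)) d<B) (go ds ds<B) ⟩
      B * B ^ length ds ∎
      where
      open ≤-Reasoning
      P = product (map (λ d → d + 1) ds)
      Z = B ^ length (filter (0 ≟_) ds)

  sloane≤B* : ∀ n → 1 ≤ n → S n ≤ B * n
  sloane≤B* n 1≤n = ≤-trans (m≤m*n (S n) (B ^ countDigit B 0 n) {{m^n≢0 B (countDigit B 0 n)}}) (sloane*B^count₀≤ n 1≤n)

  sloane<-two-zeros : ∀ n → 1 ≤ n → 2 ≤ countDigit B 0 n → S n < n
  sloane<-two-zeros n 1≤n two≤zeros = begin-strict
    S n         <⟨ m<m*n (S n) B {{>-nonZero (sloane-pos n)}} (s≤s (s≤s z≤n)) ⟩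
    S n * B     ≤⟨ *-cancelʳ-≤ (S n * B) n B (begin
      S n * B * B                  ≡⟨ *-assoc (S n) B B ⟩
      S n * (B * B)                ≡⟨ cong (λ x → S n * (B * x)) (*-identityʳ B) ⟨
      S n * B ^ 2                  ≤⟨ *-monoʳ-≤ (S n) (^-monoʳ-≤ B two≤zeros) ⟩
      S n * B ^ countDigit B 0 n   ≤⟨ sloane*B^count₀≤ n 1≤n ⟩
      B * n                        ≡⟨ *-comm B n ⟩
      n * B                        ∎) ⟩
    n           ∎
    where open ≤-Reasoning

  ^count∣sloane : ∀ δ n → suc δ ^ countDigit B δ n ∣ S n
  ^count∣sloane δ n = go (digits B n)
    where
    go : ∀ ds → suc δ ^ length (filter (δ ≟_) ds) ∣ product (map (λ d → d + 1) ds)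
    go [] = ∣-refl
    go (d ∷ ds) with δ ≟ d
    ... | yes refl rewrite filter-accept (δ ≟_) {δ} {ds} refl =
      subst (λ x → suc δ * suc δ ^ length (filter (δ ≟_) ds) ∣ x * product (map (λ d → d + 1) ds))
        (+-comm 1 δ) (*-monoʳ-∣ (suc δ) (go ds))
    ... | no δ≢d rewrite filter-reject (δ ≟_) {d} {ds} δ≢d = ∣n⇒∣m*n (d + 1) (go ds)

record PrimesUpTo (b : ℕ) : Set where
  field
    k : ℕ
    p : Fin (suc k) → ℕ
    p-prime : ∀ i → Prime (p i)
    p-≤ : ∀ i → p i ≤ b
    p-injective : Injective _≡_ _≡_ p
    p-complete : ∀ q → Prime q → q ≤ b → ∃ λ i → p i ≡ q

module Smooth (c : ℕ) (𝒫 : PrimesUpTo (suc (suc c))) where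
  open Base c
  open PrimesUpTo 𝒫

  monomial : (Fin (suc k) → ℕ) → ℕ
  monomial E = prodFin (suc k) (λ i → p i ^ E i)

  Smooth : ℕ → Set
  Smooth z = ∃ λ E → z ≡ monomial E

  monomial-pos : ∀ E → 1 ≤ monomial E
  monomial-pos E = begin
    1                            ≡⟨ ^-zeroˡ (suc k) ⟨
    1 ^ suc k                    ≡⟨ prodFin-const (suc k) 1 ⟨
    prodFin (suc k) (λ _ → 1)    ≤⟨ prodFin-mono-≤ (suc k) (λ i → prime^n>0 (p-prime i) (E i)) ⟩
    monomial E                   ∎
    where open ≤-Reasoning

  monomial-+ : ∀ E F → monomial (λ i → E i + F i) ≡ monomial E * monomial F
  monomial-+ E F = trans (prodFin-cong (suc k) (λ i → ^-distribˡ-+-* (p i) (E i) (F i)))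
    (prodFin-* (suc k) (λ i → p i ^ E i) (λ i → p i ^ F i))

  smooth-1 : Smooth 1
  smooth-1 = (λ _ → 0) , sym (trans (prodFin-const (suc k) 1) (^-zeroˡ (suc k)))

  smooth-* : ∀ {x y} → Smooth x → Smooth y → Smooth (x * y)
  smooth-* (E , x≡) (F , y≡) = (λ i → E i + F i) , trans (cong₂ _*_ x≡ y≡) (sym (monomial-+ E F))

  smooth-prime : ∀ q → Prime q → q ≤ B → Smooth q
  smooth-prime q q-prime q≤B with p-complete q q-prime q≤B
  ... | j , refl = unitVector j , sym (prodFin-^unitVector (suc k) p j)

  smooth-primes : ∀ qs → All Prime qs → product qs ≤ B → Smooth (product qs)
  smooth-primes [] [] _ = smooth-1
  smooth-primes (q ∷ qs) (q-prime ∷ qs-prime) q*qs≤B = smooth-*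
    (smooth-prime q q-prime (≤-trans (m≤m*n q (product qs) {{productOfPrimes≢0 qs-prime}}) q*qs≤B))
    (smooth-primes qs qs-prime (≤-trans (m≤n*m (product qs) q {{prime⇒nonZero q-prime}}) q*qs≤B))

  smooth-≤B : ∀ m → 1 ≤ m → m ≤ B → Smooth m
  smooth-≤B (suc m) _ m≤B = subst Smooth (sym m≡∏)
    (smooth-primes (PrimeFactorisation.factors F) (PrimeFactorisation.factorsPrime F) (subst (_≤ B) m≡∏ m≤B))
    where
    F = factorise (suc m)
    m≡∏ = PrimeFactorisation.isFactorisation F

  sloane-smooth : ∀ n → Smooth (S n)
  sloane-smooth n = go (digits B n) (digits-< n)
    where
    go : ∀ ds → All (_< B) ds → Smooth (product (map (λ d → d + 1) ds))
    go [] [] = smooth-1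
    go (d ∷ ds) (d<B ∷ ds<B) =
      smooth-* (smooth-≤B (d + 1) (m≤n+m 1 d) (subst (_≤ B) (+-comm 1 d) d<B)) (go ds ds<B)

  -- Kept opaque: unfolding this witness during unification is very expensive.
  opaque
    smooth-B : Smooth B
    smooth-B = smooth-≤B B (s≤s z≤n) ≤-refl

  v : Fin (suc k) → ℕ
  v = proj₁ smooth-B

  B≡monomial-v : B ≡ monomial v
  B≡monomial-v = proj₂ smooth-B

  p^v∣B : ∀ r → p r ^ v r ∣ B
  p^v∣B r = divides (prodFin k ((λ i → p i ^ v i) ∘ punchIn r))
    (trans B≡monomial-v (trans (prodFin-punchIn k (λ i → p i ^ v i) r) (*-comm (p r ^ v r) _)))

  p∣B : ∀ r → 1 ≤ v r → p r ∣ B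
  p∣B r 1≤v = ∣-trans (m∣m^n (p r) 1≤v) (p^v∣B r)

  -- An exponent below that of B witnesses B ∤ w.
  Reduced : ℕ → Set
  Reduced w = Σ (Fin (suc k) → ℕ) λ E → w ≡ monomial E × ∃ λ r → E r < v r

  reduced-pos : ∀ {w} → Reduced w → 1 ≤ w
  reduced-pos (E , refl , _) = monomial-pos E

  monomial-divide-B : ∀ E → (∀ i → v i ≤ E i) → monomial E ≡ B * monomial (λ i → E i ∸ v i)
  monomial-divide-B E v≤E = begin
    monomial E                                  ≡⟨ prodFin-cong (suc k) (λ i → cong (p i ^_) (sym (m+[n∸m]≡n (v≤E i)))) ⟩
    monomial (λ i → v i + (E i ∸ v i))          ≡⟨ monomial-+ v (λ i → E i ∸ v i) ⟩
    monomial v * monomial (λ i → E i ∸ v i)     ≡⟨ cong (_* monomial (λ i → E i ∸ v i)) B≡monomial-v ⟨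
    B * monomial (λ i → E i ∸ v i)              ∎
    where open ≡-Reasoning

  smooth-decomposition : ∀ z → Smooth z → ∃ λ i → ∃ λ w → z ≡ B ^ i * w × Reduced w
  smooth-decomposition = <-rec _ go
    where
    go : ∀ z → (∀ {y} → y < z → Smooth y → ∃ λ i → ∃ λ w → y ≡ B ^ i * w × Reduced w) →
         Smooth z → ∃ λ i → ∃ λ w → z ≡ B ^ i * w × Reduced w
    go z rec (E , z≡) with Fin.any? (λ r → E r <? v r)
    ... | yes E≱v = 0 , z , sym (+-identityʳ z) , E , z≡ , E≱v
    ... | no E≱v = lift (rec y<z (E′ , refl))
      where
      E′ = λ i → E i ∸ v i
      y = monomial E′
      z≡By : z ≡ B * y
      z≡By = trans z≡ (monomial-divide-B E (λ i → ≮⇒≥ (E≱v ∘ (i ,_))))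
      y<z : y < z
      y<z = subst (y <_) (sym (trans z≡By (*-comm B y))) (m<m*n y B {{>-nonZero (monomial-pos E′)}} (s≤s (s≤s z≤n)))
      lift : (∃ λ i → ∃ λ w → y ≡ B ^ i * w × Reduced w) → ∃ λ i → ∃ λ w → z ≡ B ^ i * w × Reduced w
      lift (i , w , y≡ , reduced) = suc i , w , trans z≡By (trans (cong (B *_) y≡) (sym (*-assoc B (B ^ i) w))) , reduced

EquidistributedBeyond : (q : ℕ) → ℚ.ℚ → (k a : ℕ) → (Fin k → ℕ) → ℕ → Set
EquidistributedBeyond q ε k a ps N =
  ∀ (α : Fin k → ℕ) → (∃ λ i → N ≤ α i) → Equidistributed q ε (a * prodFin k (λ i → ps i ^ α i))

equidistributedBeyond-upwardClosed : ∀ q ε k a ps → UpwardClosed (EquidistributedBeyond q ε k a ps)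
equidistributedBeyond-upwardClosed q ε k a ps M≤N beyondM α (i , N≤αi) = beyondM α (i , ≤-trans M≤N N≤αi)

EventuallyEquidistributed : (q : ℕ) → ℚ.ℚ → (k a : ℕ) → (Fin k → ℕ) → Set
EventuallyEquidistributed q ε k a ps = ∃ (EquidistributedBeyond q ε k a ps)

-- The common consequence of Conjectures A and B that the proof uses.
EquidistributionHypothesis : (b k : ℕ) → (Fin (suc k) → ℕ) → Set
EquidistributionHypothesis b k p =
  ∀ r e → p r ∣ b → EventuallyEquidistributed b (frac 1 (b + b)) k (p r ^ e) (p ∘ punchIn r)

module Persistence
  (c : ℕ) (𝒫 : PrimesUpTo (suc (suc c)))
  (hypothesis : EquidistributionHypothesis (suc (suc c)) (PrimesUpTo.k 𝒫) (PrimesUpTo.p 𝒫))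
  (δ : ℕ) (1≤δ : 1 ≤ δ) (δ<B : δ < suc (suc c)) (δ+1-prime : Prime (suc δ)) (δ+1∤B : suc δ ∤ suc (suc c))
  where
  open Base c
  open PrimesUpTo 𝒫
  open Smooth c 𝒫

  ε : ℚ.ℚ
  ε = frac 1 (B + B)

  -- Kept opaque: unfolding this witness during unification is very expensive.
  opaque
    uniform-threshold : ∃ λ N → ∀ r e → e < v r → EquidistributedBeyond B ε k (p r ^ e) (p ∘ punchIn r) N
    uniform-threshold = uniform-bound-Fin (λ r N → ∀ e → e < v r → Beyond r e N)
      (λ r m≤n beyond e e<v → upwardClosed r e m≤n (beyond e e<v))
      (λ r → uniform-bound-< (v r) (Beyond r) (upwardClosed r)
        (λ e e<v → hypothesis r e (p∣B r (≤-trans (s≤s z≤n) e<v))))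
      where
      Beyond : Fin (suc k) → ℕ → ℕ → Set
      Beyond r e = EquidistributedBeyond B ε k (p r ^ e) (p ∘ punchIn r)
      upwardClosed : ∀ r e → UpwardClosed (Beyond r e)
      upwardClosed r e = equidistributedBeyond-upwardClosed B ε k (p r ^ e) (p ∘ punchIn r)

  N* : ℕ
  N* = proj₁ uniform-threshold

  -- Bounds the reduced numbers with every α_i < N*, using p_r^e ≤ p_r^(v r) ≤ B.
  W₀ : ℕ
  W₀ = B * (B ^ N*) ^ k

  reduced-form-bounded : ∀ r e (α : Fin k → ℕ) → e ≤ v r → (∀ i → α i < N*) →
                         p r ^ e * prodFin k (λ i → p (punchIn r i) ^ α i) ≤ W₀
  reduced-form-bounded r e α e≤v α<N = *-mono-≤ p^e≤B (begin
    prodFin k (λ i → p (punchIn r i) ^ α i) ≤⟨ prodFin-mono-≤ k (λ i →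
      ≤-trans (^-monoˡ-≤ (α i) (p-≤ (punchIn r i))) (^-monoʳ-≤ B (<⇒≤ (α<N i)))) ⟩
    prodFin k (λ _ → B ^ N*)                ≡⟨ prodFin-const k (B ^ N*) ⟩
    (B ^ N*) ^ k                            ∎)
    where
    open ≤-Reasoning
    p^e≤B : p r ^ e ≤ B
    p^e≤B = ≤-trans (^-monoʳ-≤ (p r) {{prime⇒nonZero (p-prime r)}} e≤v) (∣⇒≤ (p^v∣B r))

  reduced-form-equidistributed : ∀ r e (α : Fin k → ℕ) → e < v r →
    W₀ < p r ^ e * prodFin k (λ i → p (punchIn r i) ^ α i) →
    Equidistributed B ε (p r ^ e * prodFin k (λ i → p (punchIn r i) ^ α i))
  reduced-form-equidistributed r e α e<v W₀< with Fin.any? (λ i → N* ≤? α i)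
  ... | yes large = proj₂ uniform-threshold r e e<v α large
  ... | no small = contradiction (reduced-form-bounded r e α (<⇒≤ e<v) (λ i → ≰⇒> (small ∘ (i ,_)))) (<⇒≱ W₀<)

  reduced-equidistributed : ∀ {w} → Reduced w → W₀ < w → Equidistributed B ε w
  reduced-equidistributed (E , refl , r , Er<vr) W₀<w = subst (Equidistributed B ε) (sym split)
    (reduced-form-equidistributed r (E r) (E ∘ punchIn r) Er<vr (subst (W₀ <_) split W₀<w))
    where
    split = prodFin-punchIn k (λ i → p i ^ E i) r

  equidistributed⇒count : ∀ w d → 1 ≤ w → Equidistributed B ε w → d < B → L w < (B + B) * countDigit B d w
  equidistributed⇒count (suc n) d _ equi d<B =
    subst (λ l → ℚ.∣ frac (countDigit B d (suc n)) l ℚ.- frac 1 B ∣ ℚ.< ε → l < (B + B) * countDigit B d (suc n))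
      (sym (numDigits-suc n)) (∣c/m-1/b∣<1/2b⇒m<2bc (suc c) (countDigit B d (suc n)) (L (suc n / B))) (equi d d<B)

  W : ℕ
  W = W₀ + B ^ (B + B)

  reduced-two-zeros : ∀ {w} → Reduced w → W < w → 2 ≤ countDigit B 0 w
  reduced-two-zeros {w} reduced W<w = *-cancelˡ-< (B + B) 1 (countDigit B 0 w) (begin-strict
    (B + B) * 1               ≡⟨ *-identityʳ (B + B) ⟩
    B + B                     <⟨ ^-cancelʳ-< B (begin-strict
      B ^ (B + B)               ≤⟨ m≤n+m (B ^ (B + B)) W₀ ⟩
      W                         <⟨ W<w ⟩
      w                         <⟨ n<B^L w ⟩
      B ^ L w                   ∎) ⟩
    L w                       <⟨ equidistributed⇒count w 0 (reduced-pos reduced)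
                                   (reduced-equidistributed reduced (≤-<-trans (m≤m+n W₀ _) W<w)) (s≤s z≤n) ⟩
    (B + B) * countDigit B 0 w ∎)
    where open ≤-Reasoning

  B^i*reduced-two-zeros : ∀ i {w} → Reduced w → B * W < B ^ i * w → 2 ≤ countDigit B 0 (B ^ i * w)
  B^i*reduced-two-zeros zero {w} reduced BW<w =
    subst (2 ≤_) (sym (count₀-B^* 0 w (reduced-pos reduced)))
      (reduced-two-zeros reduced (≤-<-trans (m≤n*m W B) (subst (B * W <_) (+-identityʳ w) BW<w)))
  B^i*reduced-two-zeros (suc zero) {w} reduced BW<Bw =
    subst (2 ≤_) (sym (count₀-B^* 1 w (reduced-pos reduced)))
      (≤-trans (reduced-two-zeros reduced (*-cancelˡ-< B W w (subst (λ b → B * W < b * w) (*-identityʳ B) BW<Bw))) (m≤n+m _ 1))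
  B^i*reduced-two-zeros (suc (suc i)) {w} reduced _ =
    subst (2 ≤_) (sym (count₀-B^* (suc (suc i)) w (reduced-pos reduced))) (s≤s (s≤s z≤n))

  sloane∘sloane< : ∀ u → B * W < S u → S (S u) < S u
  sloane∘sloane< u BW<Su with smooth-decomposition (S u) (sloane-smooth u)
  ... | i , w , Su≡ , reduced = sloane<-two-zeros (S u) (sloane-pos u)
    (subst (λ x → 2 ≤ countDigit B 0 x) (sym Su≡) (B^i*reduced-two-zeros i reduced (subst (B * W <_) Su≡ BW<Su)))

  threshold : ℕ
  threshold = suc (B * (B * W))

  large⇒aperiodic : ∀ y → threshold ≤ y → ¬ Periodic S y
  large⇒aperiodic y threshold≤y (m , cycle) with cycle-peak S {y} {m} cycle
  ... | u , y≤SSu , Su≤SSu with B * W <? S u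
  ...   | yes BW<Su = <⇒≱ (sloane∘sloane< u BW<Su) Su≤SSu
  ...   | no BW≮Su = <⇒≱ (begin-strict
    S (S u)       ≤⟨ sloane≤B* (S u) (sloane-pos u) ⟩
    B * S u       ≤⟨ *-monoʳ-≤ B (≮⇒≥ BW≮Su) ⟩
    B * (B * W)   <⟨ threshold≤y ⟩
    y             ∎) y≤SSu
    where open ≤-Reasoning

  ℓ : ℕ
  ℓ = suc threshold

  growth : ℕ
  growth = (B + B) * B

  Long : ℕ → ℕ → Set
  Long j x = ∃ λ i → ∃ λ w → x ≡ B ^ i * w × Reduced w × ℓ * growth ^ j ≤ L w

  ℓ≤ℓ*growth^j : ∀ j → ℓ ≤ ℓ * growth ^ j
  ℓ≤ℓ*growth^j j = m≤m*n ℓ (growth ^ j) {{m^n≢0 growth j}}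

  many-digits⇒large : ∀ w → 1 ≤ w → ℓ ≤ L w → threshold < w
  many-digits⇒large w 1≤w ℓ≤L = *-cancelˡ-≤ B (begin
    B * suc threshold   ≤⟨ *-monoʳ-≤ B (n<2^n threshold) ⟩
    B * 2 ^ threshold   ≤⟨ *-monoʳ-≤ B (^-monoˡ-≤ threshold (s≤s (s≤s z≤n))) ⟩
    B ^ ℓ               ≤⟨ ^-monoʳ-≤ B ℓ≤L ⟩
    B ^ L w             ≤⟨ B^L≤B* w 1≤w ⟩
    B * w               ∎)
    where open ≤-Reasoning

  long⇒large : ∀ {j x} → Long j x → threshold ≤ x
  long⇒large {j} (i , w , refl , reduced , long) = begin
    threshold    ≤⟨ <⇒≤ (many-digits⇒large w (reduced-pos reduced) (≤-trans (ℓ≤ℓ*growth^j j) long)) ⟩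
    w            ≤⟨ m≤n*m w (B ^ i) {{m^n≢0 B i}} ⟩
    B ^ i * w    ∎
    where open ≤-Reasoning

  -- p ∤ B, so p^c divides w < B^(L w) ≤ 2^(B L w).
  p^c∣⇒c<B*L : ∀ i w c → Reduced w → suc δ ^ c ∣ B ^ i * w → c < B * L w
  p^c∣⇒c<B*L i w c reduced p^c∣ = ^-cancelʳ-< 2 (begin-strict
    2 ^ c            ≤⟨ ^-monoˡ-≤ c (prime⇒2≤ δ+1-prime) ⟩
    suc δ ^ c        ≤⟨ ∣⇒≤ {{>-nonZero (reduced-pos reduced)}}
                          (prime^∣-cancelˡ δ+1-prime (prime∤⇒∤^ δ+1-prime δ+1∤B i) c w p^c∣) ⟩
    w                <⟨ n<B^L w ⟩
    B ^ L w          ≤⟨ ^-monoˡ-≤ (L w) (<⇒≤ (n<2^n B)) ⟩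
    (2 ^ B) ^ L w    ≡⟨ ^-*-assoc 2 B (L w) ⟩
    2 ^ (B * L w)    ∎)
    where open ≤-Reasoning

  smooth-divisible⇒long : ∀ j x c → Smooth x → B * (ℓ * growth ^ j) ≤ c → suc δ ^ c ∣ x → Long j x
  smooth-divisible⇒long j x c smooth c-large p^c∣x with smooth-decomposition x smooth
  ... | i , w , x≡ , reduced = i , w , x≡ , reduced ,
    <⇒≤ (*-cancelˡ-< B _ _ (≤-<-trans c-large (p^c∣⇒c<B*L i w c reduced (subst (suc δ ^ c ∣_) x≡ p^c∣x))))

  -- The digit δ occurs in an equidistributed w at least L w / 2B times, and each occurrence
  -- contributes a factor δ + 1 to S.
  long-step : ∀ {j x} → Long (suc j) x → Long j (S x)
  long-step {j} (i , w , refl , reduced , long) =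
    smooth-divisible⇒long j (S (B ^ i * w)) (countDigit B δ w) (sloane-smooth (B ^ i * w)) many-δ
      (subst (λ n → suc δ ^ n ∣ S (B ^ i * w)) (count-B^* δ i w 1≤δ 1≤w) (^count∣sloane δ (B ^ i * w)))
    where
    1≤w = reduced-pos reduced
    equi : Equidistributed B ε w
    equi = reduced-equidistributed reduced (begin-strict
      W₀           ≤⟨ m≤m+n W₀ _ ⟩
      W            ≤⟨ m≤n*m W B ⟩
      B * W        ≤⟨ m≤n*m (B * W) B ⟩
      B * (B * W)  <⟨ n<1+n (B * (B * W)) ⟩
      threshold    <⟨ many-digits⇒large w 1≤w (≤-trans (ℓ≤ℓ*growth^j (suc j)) long) ⟩
      w            ∎)
      where open ≤-Reasoning
    many-δ : B * (ℓ * growth ^ j) ≤ countDigit B δ w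
    many-δ = <⇒≤ (*-cancelˡ-< (B + B) _ _ (begin-strict
      (B + B) * (B * (ℓ * growth ^ j))  ≡⟨ *-assoc (B + B) B (ℓ * growth ^ j) ⟨
      growth * (ℓ * growth ^ j)         ≡⟨ x∙yz≈y∙xz growth ℓ (growth ^ j) ⟩
      ℓ * growth ^ suc j                ≤⟨ long ⟩
      L w                               <⟨ equidistributed⇒count w δ 1≤w equi δ<B ⟩
      (B + B) * countDigit B δ w        ∎))
      where open ≤-Reasoning

  long-iterate⇒large : ∀ k {j x} → k ≤ j → Long j x → threshold ≤ iter S k x
  long-iterate⇒large zero {j} _ long = long⇒large {j} long
  long-iterate⇒large (suc k) {suc j} {x} (s≤s k≤j) long =
    subst (threshold ≤_) (sym (iter-suc S k x)) (long-iterate⇒large k k≤j (long-step {j} long))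

  repdigit : ℕ → ℕ
  repdigit zero = 0
  repdigit (suc n) = δ + repdigit n * B

  digits-repdigit : ∀ n → digits B (repdigit n) ≡ replicate n δ
  digits-repdigit zero = refl
  digits-repdigit (suc n) =
    trans (digits-+* δ (repdigit n) δ<B (≤-trans 1≤δ (m≤m+n δ _))) (cong (δ ∷_) (digits-repdigit n))

  sloane-repdigit : ∀ n → S (repdigit n) ≡ suc δ ^ n
  sloane-repdigit n = trans (cong (λ ds → product (map (λ d → d + 1) ds)) (digits-repdigit n)) (go n)
    where
    go : ∀ n → product (map (λ d → d + 1) (replicate n δ)) ≡ suc δ ^ n
    go zero = refl
    go (suc n) = cong₂ _*_ (+-comm δ 1) (go n)

  n≤repdigit : ∀ n → n ≤ repdigit n
  n≤repdigit zero = z≤n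
  n≤repdigit (suc n) = +-mono-≤ 1≤δ (≤-trans (n≤repdigit n) (m≤m*n (repdigit n) B))

  unbounded : ∀ t → ∃ λ n → 1 ≤ n × PersistenceAtLeast B t n
  unbounded t = n , ≤-trans (s≤s z≤n) threshold≤n ,
    λ k k<t → large⇒aperiodic (iter S k n) (large k k<t)
    where
    M = B * (ℓ * growth ^ t)
    n = repdigit M
    threshold≤n : threshold ≤ n
    threshold≤n = ≤-trans (n≤1+n threshold) (≤-trans (ℓ≤ℓ*growth^j t) (≤-trans (m≤n*m _ B) (n≤repdigit M)))
    long : Long t (S n)
    long = smooth-divisible⇒long t (S n) M (sloane-smooth n) ≤-refl (subst (suc δ ^ M ∣_) (sym (sloane-repdigit M)) ∣-refl)
    large : ∀ k → k < t → threshold ≤ iter S k n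
    large zero _ = threshold≤n
    large (suc k) k<t = subst (threshold ≤_) (sym (iter-suc S k n)) (long-iterate⇒large k (≤-trans (n≤1+n k) (<⇒≤ k<t)) long)

lookup-injective : ∀ (xs : List ℕ) → Unique xs → Injective _≡_ _≡_ (lookup xs)
lookup-injective (x ∷ xs) (x∉xs ∷ unique) {fzero} {fzero} _ = refl
lookup-injective (x ∷ xs) (x∉xs ∷ unique) {fzero} {fsuc j} x≡ = ⊥-elim (All.lookup x∉xs (∈-lookup j) x≡)
lookup-injective (x ∷ xs) (x∉xs ∷ unique) {fsuc i} {fzero} ≡x = ⊥-elim (All.lookup x∉xs (∈-lookup i) (sym ≡x))
lookup-injective (x ∷ xs) (x∉xs ∷ unique) {fsuc i} {fsuc j} eq = cong fsuc (lookup-injective xs unique eq)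

cast-injective : ∀ {m n} (eq : m ≡ n) → Injective _≡_ _≡_ (cast eq)
cast-injective eq {i} {j} cast≡ = trans (sym (Fin.cast-involutive (sym eq) eq i))
  (trans (cong (cast (sym eq)) cast≡) (Fin.cast-involutive (sym eq) eq j))

primesUpTo : ∀ c → PrimesUpTo (suc (suc c))
primesUpTo c = record
  { k = pred (length ps)
  ; p = p
  ; p-prime = λ i → proj₂ (∈-filter⁻ prime? {xs = range} (p∈ps i))
  ; p-≤ = λ i → s≤s⁻¹ (∈-upTo⁻ (proj₁ (∈-filter⁻ prime? {xs = range} (p∈ps i))))
  ; p-injective = cast-injective length≡ ∘ lookup-injective ps (filter⁺ prime? (upTo⁺ (suc (suc (suc c)))))
  ; p-complete = complete
  }
  where
  range = upTo (suc (suc (suc c)))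
  ps = filter prime? range
  length≡ : suc (pred (length ps)) ≡ length ps
  length≡ = suc-pred (length ps) {{nonEmpty (∈-filter⁺ prime? {xs = range} (∈-upTo⁺ (s≤s (s≤s (s≤s z≤n)))) prime[2])}}
    where
    nonEmpty : ∀ {x} {xs : List ℕ} → x ∈ xs → NonZero (length xs)
    nonEmpty (here _) = _
    nonEmpty (there _) = _
  p : Fin (suc (pred (length ps))) → ℕ
  p i = lookup ps (cast length≡ i)
  p∈ps : ∀ i → p i ∈ ps
  p∈ps i = ∈-lookup (cast length≡ i)
  complete : ∀ q → Prime q → q ≤ suc (suc c) → ∃ λ i → p i ≡ q
  complete q q-prime q≤b = cast (sym length≡) (index q∈ps) ,
    trans (cong (lookup ps) (Fin.cast-involutive length≡ (sym length≡) (index q∈ps))) (sym (lookup-index q∈ps))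
    where
    q∈ps = ∈-filter⁺ prime? {xs = range} (∈-upTo⁺ (s≤s q≤b)) q-prime

prodSeq-const : ∀ a q n → prodSeq a (λ _ → q) n ≡ a * q ^ n
prodSeq-const a q zero = sym (*-identityʳ a)
prodSeq-const a q (suc n) = trans (cong (_* q) (prodSeq-const a q n))
  (trans (*-assoc a (q ^ n) q) (cong (a *_) (*-comm (q ^ n) q)))

ε-positive : ∀ c → ℚ.Positive (frac 1 (suc (suc c) + suc (suc c)))
ε-positive c = ℚ.normalize-pos 1 (suc (suc c) + suc (suc c))

module _ (c : ℕ) {k} {p : Fin (suc k) → ℕ} (p-prime : ∀ i → Prime (p i)) (p-injective : Injective _≡_ _≡_ p) where

  punchIn-misses-prime : ∀ r → p r ∣ suc (suc c) → ¬ (∀ q → Prime q → q ∣ suc (suc c) → ∃ λ i → p (punchIn r i) ≡ q)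
  punchIn-misses-prime r p∣B covers = let i , p≡ = covers (p r) (p-prime r) p∣B in Fin.punchInᵢ≢i r i (p-injective p≡)

  conjectureB⇒hypothesis : ConjectureB → EquidistributionHypothesis (suc (suc c)) k p
  conjectureB⇒hypothesis conjB r e p∣B =
    conjB (suc (suc c)) (s≤s (s≤s z≤n)) k (p ∘ punchIn r) (Fin.punchIn-injective r _ _ ∘ p-injective)
      (p-prime ∘ punchIn r) (punchIn-misses-prime r p∣B) (p r ^ e) (prime^n>0 (p-prime r) e) _ (ε-positive c)

conjectureA⇒eventuallyEquidistributed : ConjectureA → ∀ b → 1 < b → ∀ a → 1 ≤ a → (ps : Fin 1 → ℕ) →
  Prime (ps fzero) → ¬ (∀ q → Prime q → q ∣ b → ∃ λ i → ps i ≡ q) → ∀ ε → ℚ.Positive ε →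
  EventuallyEquidistributed b ε 1 a ps
conjectureA⇒eventuallyEquidistributed conjA b 1<b a 1≤a ps q-prime missing ε ε-pos
  with conjA b 1<b (ps fzero ∷ []) (q-prime ∷ [])
         (λ covers → missing (λ q q-prime q∣b → fzero , ∈-singleton (covers q q-prime q∣b)))
         a 1≤a (λ _ → ps fzero) (λ _ → here refl) ε ε-pos
  where
  ∈-singleton : ∀ {q r} → q ∈ r ∷ [] → r ≡ q
  ∈-singleton (here q≡r) = sym q≡r
... | n₀ , equidistributed = n₀ , λ
  { α (fzero , n₀≤α) → subst (Equidistributed b ε)
      (trans (prodSeq-const a (ps fzero) (α fzero)) (cong (a *_) (sym (*-identityʳ _))))
      (equidistributed (α fzero) n₀≤α) }

conjectureA⇒hypothesis : ConjectureA → ∀ c {p : Fin 2 → ℕ} (p-prime : ∀ i → Prime (p i)) → Injective _≡_ _≡_ p →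
                         EquidistributionHypothesis (suc (suc c)) 1 p
conjectureA⇒hypothesis conjA c {p} p-prime p-injective r e p∣B =
  conjectureA⇒eventuallyEquidistributed conjA (suc (suc c)) (s≤s (s≤s z≤n)) (p r ^ e) (prime^n>0 (p-prime r) e)
    (p ∘ punchIn r) (p-prime (punchIn r fzero)) (punchIn-misses-prime c p-prime p-injective r p∣B) _ (ε-positive c)

prime-factor : ∀ n → 2 ≤ n → ∃ λ q → Prime q × q ∣ n
prime-factor (suc zero) (s≤s ())
prime-factor (suc (suc n)) _ with factorise (suc (suc n))
... | record { factors = q ∷ qs ; isFactorisation = n≡ ; factorsPrime = q-prime ∷ _ } =
  q , q-prime , divides (product qs) (trans n≡ (*-comm q (product qs)))

-- A prime factor of B − 1 is ≤ B and does not divide B.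
digit-below-prime : ∀ c → ∃ λ δ → 1 ≤ δ × δ < 3 + c × Prime (suc δ) × suc δ ∤ 3 + c
digit-below-prime c with prime-factor (2 + c) (s≤s (s≤s z≤n))
... | zero , 0-prime , _ = contradiction 0-prime ¬prime[0]
... | suc δ , q-prime , q∣B-1 =
  δ , s≤s⁻¹ (prime⇒2≤ q-prime) , m≤n⇒m≤1+n (∣⇒≤ q∣B-1) , q-prime ,
  λ q∣B → <⇒≱ (prime⇒2≤ q-prime) (∣⇒≤ (∣m+n∣m⇒∣n (subst (suc δ ∣_) (+-comm 1 (2 + c)) q∣B) q∣B-1))

unbounded-persistence : ∀ c (𝒫 : PrimesUpTo (3 + c)) →
  EquidistributionHypothesis (3 + c) (PrimesUpTo.k 𝒫) (PrimesUpTo.p 𝒫) →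
  ∀ t → ∃ λ n → 1 ≤ n × PersistenceAtLeast (3 + c) t n
unbounded-persistence c 𝒫 hypothesis with digit-below-prime c
... | δ , 1≤δ , δ<B , δ+1-prime , δ+1∤B = Persistence.unbounded (suc c) 𝒫 hypothesis δ 1≤δ δ<B δ+1-prime δ+1∤B

theorem10 : (ConjectureA → (b : ℕ) → (b ≡ 3 ⊎ b ≡ 4) → (t : ℕ) → 1 ≤ t → ∃ λ n → 1 ≤ n × PersistenceAtLeast b t n)
          × (ConjectureB → (b : ℕ) → 5 ≤ b → (t : ℕ) → 1 ≤ t → ∃ λ n → 1 ≤ n × PersistenceAtLeast b t n)
theorem10 = part-a , part-b
  where
  open PrimesUpTo using (p-prime; p-injective)
  part-a : ConjectureA → (b : ℕ) → (b ≡ 3 ⊎ b ≡ 4) → (t : ℕ) → 1 ≤ t → ∃ λ n → 1 ≤ n × PersistenceAtLeast b t n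
  -- The primes up to 3 and up to 4 are 2 and 3 alone, so k reduces to 1 there.
  part-a conjA .3 (inj₁ refl) t _ = unbounded-persistence 0 (primesUpTo 1)
    (conjectureA⇒hypothesis conjA 1 (p-prime (primesUpTo 1)) (p-injective (primesUpTo 1))) t
  part-a conjA .4 (inj₂ refl) t _ = unbounded-persistence 1 (primesUpTo 2)
    (conjectureA⇒hypothesis conjA 2 (p-prime (primesUpTo 2)) (p-injective (primesUpTo 2))) t
  part-b : ConjectureB → (b : ℕ) → 5 ≤ b → (t : ℕ) → 1 ≤ t → ∃ λ n → 1 ≤ n × PersistenceAtLeast b t n
  part-b conjB (suc (suc (suc c))) (s≤s (s≤s (s≤s _))) t _ = unbounded-persistence c (primesUpTo (suc c))
    (conjectureB⇒hypothesis (suc c) (p-prime (primesUpTo (suc c))) (p-injective (primesUpTo (suc c))) conjB) t
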